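{- Let $\mu\subseteq\lambda$ be partitions and let $X_\mu^\lambda$ and $\Phi$ be as defined in the context. Then for every $T\in X_\mu^\lambda$, $\Phi(T)$ is an element of $X_\mu^\lambda$; that is, $\Phi$ is a well-defined map $X_\mu^\lambda\to X_\mu^\lambda$.
   Context: Partitions are identified with their Young diagrams (English convention, cell $(i,j)$ in row $i$, column $j$). For partitions $\mu\subseteq\lambda$, let $\mathcal{C}_\mu^\lambda$ be the set of all chains $(\lambda_0,\dots,\lambda_k)$, $k\ge 0$, of partitions with $\mu=\lambda_0\subsetneq\lambda_1\subsetneq\cdots\subsetneq\lambda_k=\lambda$. Let $X_\mu^\lambda$ be the disjoint union over such chains of $\prod_{i=1}^k \mathrm{SSYT}(\lambda_i/\lambda_{i-1})$, where $\mathrm{SSYT}(\nu/\rho)$ is the set of semistandard Young tableaux (rows weakly increasing left to right, columns strictly increasing top to bottom, positive integer entries) of skew shape $\nu/\rho$. For $T=(T^{(1)},\dots,T^{(k)})\in X_\mu^\lambda$, its length is $\ell(T)=k$ and its weight is $\mathrm{wt}(T)=x^{T^{(1)}}\cdots x^{T^{(k)}}$, where $x^{U}=\prod_{c\in U}x_{U(c)}$ and $U(c)$ is the entry in cell $c$. Concatenating the $T^{(i)}$ gives a filling (also denoted $T$) of $\lambda/\mu$, not necessarily semistandard; each $T^{(i)}$ is regarded as a set of cells with entries. Total order on cells of $T$: for cells $c=(i,j)$, $c'=(i',j')$, $c<c'$ iff $T(c)<T(c')$, or $T(c)=T(c')$ and $j<j'$, or $T(c)=T(c')$, $j=j'$ and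 $i>i'$. A cell $c\in T^{(i)}$ is splittable if $|T^{(i)}|>1$ and $c$ is the largest cell of $T^{(i)}$; it is mergeable if $i>1$, $|T^{(i)}|=1$, the union $T^{(i-1)}\sqcup T^{(i)}$ is a semistandard tableau, and $c$ is larger than every cell of $T^{(i-1)}$. Let $\mathrm{cell}(T)$ be the largest cell that is splittable or mergeable, or $\emptyset$ if none exists; $T$ is called splittable (resp. mergeable) if $\mathrm{cell}(T)$ is splittable (resp. mergeable). Define $\Phi(T)$: if $T$ is splittable with $\mathrm{cell}(T)\in T^{(i)}$, $\Phi(T)=(T^{(1)},\dots,T^{(i-1)},T^{(i)}\setminus\{\mathrm{cell}(T)\},T',T^{(i+1)},\dots,T^{(k)})$ where $T'$ is the one-cell tableau consisting of $\mathrm{cell}(T)$ with its entry; if $T$ is mergeable with $\mathrm{cell}(T)\in T^{(i)}$, $\Phi(T)=(T^{(1)},\dots,T^{(i-2)},T^{(i-1)}\sqcup T^{(i)},T^{(i+1)},\dots,T^{(k)})$; if $\mathrm{cell}(T)=\emptyset$, $\Phi(T)=T$. -}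

module Defs where

open import Data.Nat using (ℕ; zero; suc; _+_; _∸_; _≤_; _<_; _<ᵇ_; _≡ᵇ_)
open import Data.Bool using (Bool; true; false; _∧_; _∨_; not; if_then_else_)
open import Data.List using (List; []; _∷_; _++_; [_]; map; concatMap; upTo; length; foldr; reverse; dropWhileᵇ)
open import Data.List.Relation.Unary.All using (All)
open import Data.List.Relation.Unary.Linked using (Linked)
open import Data.Maybe using (Maybe; just; nothing)
open import Data.Product using (_×_; _,_; proj₁; proj₂)
open import Relation.Binary.PropositionalEquality using (_≡_)
open import Relation.Nullary using (¬_)

-- Cells are (row , column), 0-indexed (row i, column j of the paper is
-- (i-1 , j-1) here; only comparisons of indices are ever used).

Cell : Set
Cell = ℕ × ℕ

part : List ℕ → ℕ → ℕ
part []       _       = 0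
part (x ∷ xs) zero    = x
part (x ∷ xs) (suc i) = part xs i

IsPartition : List ℕ → Set
IsPartition p = Linked (λ a b → b ≤ a) p × All (λ a → 0 < a) p

_∈D_ : Cell → List ℕ → Set
(i , j) ∈D p = j < part p i

_⊆D_ : List ℕ → List ℕ → Set
ρ ⊆D ν = ∀ c → c ∈D ρ → c ∈D ν

InSkew : List ℕ → List ℕ → Cell → Set
InSkew ν ρ c = c ∈D ν × ¬ (c ∈D ρ)

-- Semistandard tableaux of skew shape ν/ρ.
-- A filling is a function Cell → ℕ; only its values on ν/ρ matter.

IsSSYT : List ℕ → List ℕ → (Cell → ℕ) → Set
IsSSYT ν ρ t =
    (∀ c → InSkew ν ρ c → 1 ≤ t c)
  × (∀ i j j′ → InSkew ν ρ (i , j) → InSkew ν ρ (i , j′) → j < j′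
       → t (i , j) ≤ t (i , j′))
  × (∀ i i′ j → InSkew ν ρ (i , j) → InSkew ν ρ (i′ , j) → i < i′
       → t (i , j) < t (i′ , j))

-- Elements of X_μ^λ.
-- A step records λ_i together with the tableau T^(i) of shape λ_i/λ_{i-1}.

record Step : Set where
  constructor mkStep
  field
    shape   : List ℕ
    filling : Cell → ℕ
open Step public

ValidFrom : List ℕ → List ℕ → List Step → Set
ValidFrom prev lam []       = prev ≡ lam
ValidFrom prev lam (s ∷ ss) =
    IsPartition (shape s)
  × prev ⊆D shape s
  × ¬ (prev ≡ shape s)
  × IsSSYT (shape s) prev (filling s)
  × ValidFrom (shape s) lam ss

InX : List ℕ → List ℕ → List Step → Set
InX μ lam T = ValidFrom μ lam T

range : ℕ → ℕ → List ℕ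
range a b = map (a +_) (upTo (b ∸ a))

skewCells : List ℕ → List ℕ → List Cell
skewCells ν ρ = concatMap (λ i → map (λ j → (i , j)) (range (part ρ i) (part ν i))) (upTo (length ν))

Entry : Set
Entry = Cell × ℕ

allB : {A : Set} → (A → Bool) → List A → Bool
allB p = foldr (λ x r → p x ∧ r) true

ltCell : Entry → Entry → Bool
ltCell ((i , j) , a) ((i′ , j′) , a′) =
  (a <ᵇ a′) ∨ ((a ≡ᵇ a′) ∧ ((j <ᵇ j′) ∨ ((j ≡ᵇ j′) ∧ (i′ <ᵇ i))))

cellEq : Cell → Cell → Bool
cellEq (i , j) (i′ , j′) = (i ≡ᵇ i′) ∧ (j ≡ᵇ j′)

maxEntry : List Entry → Maybe Entry
maxEntry []       = nothing
maxEntry (e ∷ es) with maxEntry es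
... | nothing = just e
... | just m  = if ltCell e m then just m else just e

blockOf : List ℕ → Step → List Entry
blockOf prev s = map (λ c → c , filling s c) (skewCells (shape s) prev)

isSSYTᵇ : List Entry → Bool
isSSYTᵇ b = allB (λ d → 1 ≤ᵇ' proj₂ d) b ∧ allB (λ d → allB (λ e → ok d e) b) b
  where
  _≤ᵇ'_ : ℕ → ℕ → Bool
  m ≤ᵇ' n = not (n <ᵇ m)
  ok : Entry → Entry → Bool
  ok ((i , j) , a) ((i′ , j′) , a′) =
    (not ((i ≡ᵇ i′) ∧ (j <ᵇ j′)) ∨ not (a′ <ᵇ a))
    ∧ (not ((j ≡ᵇ j′) ∧ (i <ᵇ i′)) ∨ (a <ᵇ a′))

data Kind : Set where
  splitK mergeK : Kind

-- candidate: (index i-1 of the block T^(i), kind, cell with entry)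
Cand : Set
Cand = ℕ × Kind × Entry

splitC : ℕ → List Entry → List Cand
splitC idx b with 1 <ᵇ length b | maxEntry b
... | true | just c = [ (idx , splitK , c) ]
... | _    | _      = []

mergeC : ℕ → Maybe (List Entry) → List Entry → List Cand
mergeC idx (just pb) (c ∷ []) =
  if isSSYTᵇ (pb ++ [ c ]) ∧ allB (λ d → ltCell d c) pb
  then [ (idx , mergeK , c) ] else []
mergeC idx _ _ = []

-- all splittable / mergeable cells; arguments: index of current block,
-- previous shape λ_{i-1}, previous block T^(i-1) (nothing if i = 1)
cands : ℕ → List ℕ → Maybe (List Entry) → List Step → List Cand
cands idx prev pb []       = []
cands idx prev pb (s ∷ ss) =
  splitC idx (blockOf prev s) ++ mergeC idx pb (blockOf prev s)
  ++ cands (suc idx) (shape s) (just (blockOf prev s)) ss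

maxCand : List Cand → Maybe Cand
maxCand []       = nothing
maxCand (x ∷ xs) with maxCand xs
... | nothing = just x
... | just m  = if ltCell (proj₂ (proj₂ x)) (proj₂ (proj₂ m)) then just m else just x

decAt : List ℕ → ℕ → List ℕ
decAt []       _       = []
decAt (x ∷ xs) zero    = (x ∸ 1) ∷ xs
decAt (x ∷ xs) (suc r) = x ∷ decAt xs r

stripZeros : List ℕ → List ℕ
stripZeros p = reverse (dropWhileᵇ (λ x → x ≡ᵇ 0) (reverse p))

removeCell : List ℕ → Cell → List ℕ
removeCell ν (r , _) = stripZeros (decAt ν r)

-- split T^(idx+1): (λ_i \ {c}, T^(i) \ {c}) followed by (λ_i, {c})
applySplit : ℕ → Cell → List Step → List Step
applySplit _       _ []       = []
applySplit zero    c (s ∷ ss) = mkStep (removeCell (shape s) c) (filling s) ∷ s ∷ ss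
applySplit (suc n) c (s ∷ ss) = s ∷ applySplit n c ss

-- merge T^(idx) and T^(idx+1) (T^(idx+1) = {c} with entry a)
applyMerge : ℕ → Entry → List Step → List Step
applyMerge (suc zero)    (c , a) (s ∷ s′ ∷ ss) =
  mkStep (shape s′) (λ d → if cellEq d c then a else filling s d) ∷ ss
applyMerge (suc (suc n)) e       (s ∷ ss)      = s ∷ applyMerge (suc n) e ss
applyMerge _             _       ss            = ss

Φ : List ℕ → List Step → List Step
Φ μ T with maxCand (cands 0 μ nothing T)
... | nothing                    = T
... | just (idx , splitK , (c , a)) = applySplit idx c T
... | just (idx , mergeK , e)       = applyMerge idx e T

{-# OPTIONS --safe #-}
-- In the split case the cell c taken from T^(i) is maximal for the cell order, and every
-- cell right of or below c in λ_i/λ_{i-1} would be larger (rows weakly, columns strictly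
-- increase), so c is a corner of λ_i.  Hence λ_i ∖ {c} is a partition squeezed between
-- λ_{i-1} and λ_i, both new blocks are restrictions of the semistandard T^(i), and
-- λ_{i-1} ≠ λ_i ∖ {c} because T^(i) has a second cell.  In the merge case the merged
-- block is semistandard by the very test Φ performs, and λ_{i-2} ≠ λ_i because λ_i
-- contains c ∉ λ_{i-1}.

module Submission where

open import Defs
open import Data.Bool using (Bool; true; false; T; not; _∧_; _∨_; if_then_else_)
open import Data.Bool.Properties using (T-∧; T-≡)
open import Data.Empty using (⊥-elim)
open import Data.List using (List; []; _∷_; _++_; [_]; map; concatMap; upTo; length; reverse; replicate; dropWhileᵇ)
open import Data.List.Properties using (length-map; length-upTo; length-++; map-++; reverse-++; reverse-involutive; unfold-reverse)
open import Data.List.Membership.Propositional using (_∈_; _∉_; lose)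
open import Data.List.Membership.Propositional.Properties using (∈-map⁺; ∈-map⁻; ∈-++⁻; ∈-++⁺ˡ; ∈-++⁺ʳ; ∈-concatMap⁺; ∈-concatMap⁻; ∈-upTo⁺; ∈-upTo⁻)
open import Data.List.Relation.Unary.All as All using (All; []; _∷_)
open import Data.List.Relation.Unary.Any using (here; there; satisfied)
open import Data.List.Relation.Unary.Any.Properties using (reverse⁻)
open import Data.List.Relation.Unary.AllPairs using ([]; _∷_)
open import Data.List.Relation.Unary.Linked using (Linked; []; [-]; _∷_)
open import Data.List.Relation.Unary.Unique.Propositional using (Unique)
open import Data.List.Relation.Unary.Unique.Propositional.Properties using (upTo⁺)
open import Data.Maybe using (just; nothing)
open import Data.Nat using (ℕ; zero; suc; _+_; _∸_; _≤_; _<_; _<ᵇ_; _≡ᵇ_; z≤n; s≤s; _<?_)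
open import Data.Nat.Properties
open import Data.Product using (_×_; _,_; proj₁; proj₂; ∃; ∃₂)
open import Data.Product.Relation.Binary.Lex.Strict using (×-strictTotalOrder)
open import Data.Sum using (_⊎_; inj₁; inj₂; [_,_]′)
open import Function using (_∘_)
open import Function.Bundles using (Equivalence)
open import Relation.Binary.Bundles using (StrictTotalOrder)
import Relation.Binary.Construct.Flip.EqAndOrd as Flip
open import Relation.Binary.Definitions using (Cotransitive; tri<; tri≈; tri>)
open import Relation.Binary.PropositionalEquality using (_≡_; _≢_; refl; sym; trans; cong; cong₂; subst; module ≡-Reasoning)
open import Relation.Nullary using (¬_; yes; no)
open import Relation.Nullary.Reflects using (Reflects; ofʸ; ofⁿ; fromEquivalence; ¬-reflects; _×-reflects_; _⊎-reflects_; _→-reflects_)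

open Equivalence using (to; from)

≡ᵇ-reflects-≡ : ∀ m n → Reflects (m ≡ n) (m ≡ᵇ n)
≡ᵇ-reflects-≡ m n = fromEquivalence (≡ᵇ⇒≡ m n) (≡⇒≡ᵇ m n)

T⇒reflected : ∀ {A : Set} {b} → Reflects A b → T b → A
T⇒reflected (ofʸ a) _ = a

T-allB : ∀ {A : Set} {p : A → Bool} {xs} → T (allB p xs) → All (T ∘ p) xs
T-allB {xs = []}     _ = []
T-allB {xs = x ∷ xs} t = proj₁ (to T-∧ t) ∷ T-allB (proj₂ (to T-∧ t))

module _ {a ℓ₁ ℓ₂} (O : StrictTotalOrder a ℓ₁ ℓ₂) where
  private module O = StrictTotalOrder O

  <-cotrans : Cotransitive O._<_
  <-cotrans {x} x<y z with O.compare x z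
  ... | tri< x<z _ _ = inj₁ x<z
  ... | tri≈ _ x≈z _ = inj₂ (O.<-respˡ-≈ x≈z x<y)
  ... | tri> _ _ z<x = inj₂ (O.trans z<x x<y)

-- ltCell is the lexicographic order on (entry , column , reversed row).
entryKey : Entry → ℕ × ℕ × ℕ
entryKey ((i , j) , a) = a , j , i

entryKeyOrder : StrictTotalOrder _ _ _
entryKeyOrder = ×-strictTotalOrder <-strictTotalOrder
  (×-strictTotalOrder <-strictTotalOrder (Flip.strictTotalOrder <-strictTotalOrder))

module EK = StrictTotalOrder entryKeyOrder

infix 4 _≺_
_≺_ : Entry → Entry → Set
x ≺ y = entryKey x EK.< entryKey y

ltCell-reflects-≺ : ∀ x y → Reflects (x ≺ y) (ltCell x y)
ltCell-reflects-≺ ((i , j) , a) ((i′ , j′) , a′) =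
  <ᵇ-reflects-< a a′ ⊎-reflects ≡ᵇ-reflects-≡ a a′ ×-reflects
    (<ᵇ-reflects-< j j′ ⊎-reflects ≡ᵇ-reflects-≡ j j′ ×-reflects <ᵇ-reflects-< i′ i)

≺-irrefl : ∀ x → ¬ x ≺ x
≺-irrefl x = EK.irrefl EK.Eq.refl

≺-asym : ∀ {x y} → x ≺ y → ¬ y ≺ x
≺-asym = EK.asym

≺-cotrans : ∀ {x y} → x ≺ y → ∀ z → x ≺ z ⊎ z ≺ y
≺-cotrans x≺y z = <-cotrans entryKeyOrder x≺y (entryKey z)

≺-row : ∀ {i j j′ a a′} → j < j′ → a ≤ a′ → ((i , j) , a) ≺ ((i , j′) , a′)
≺-row j<j′ a≤a′ with m≤n⇒m<n∨m≡n a≤a′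
... | inj₁ a<a′ = inj₁ a<a′
... | inj₂ a≡a′ = inj₂ (a≡a′ , inj₁ j<j′)

maxEntry-nothing : ∀ es → maxEntry es ≡ nothing → es ≡ []
maxEntry-nothing []       _  = refl
maxEntry-nothing (e ∷ es) eq with maxEntry es
maxEntry-nothing (e ∷ es) () | nothing
maxEntry-nothing (e ∷ es) eq | just m with ltCell e m
maxEntry-nothing (e ∷ es) () | just m | true
maxEntry-nothing (e ∷ es) () | just m | false

maxEntry-maximal : ∀ es {m} → maxEntry es ≡ just m → m ∈ es × (∀ {x} → x ∈ es → ¬ m ≺ x)
maxEntry-maximal (e ∷ es) eq with maxEntry es in eqₑₛ
maxEntry-maximal (e ∷ es) refl | nothing with refl ← maxEntry-nothing es eqₑₛ =
  here refl , λ { (here refl) → ≺-irrefl e }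
... | just m with ltCell e m | ltCell-reflects-≺ e m | maxEntry-maximal es eqₑₛ
maxEntry-maximal (e ∷ es) refl | just m | true  | ofʸ e≺m | m∈ , m-max =
  there m∈ , λ { (here refl) → ≺-asym e≺m ; (there x∈) → m-max x∈ }
maxEntry-maximal (e ∷ es) refl | just m | false | ofⁿ e⊀m | _  , m-max =
  here refl , λ { (here refl) → ≺-irrefl e ; (there x∈) e≺x → [ e⊀m , m-max x∈ ]′ (≺-cotrans e≺x m) }

maxCand-∈ : ∀ {xs m} → maxCand xs ≡ just m → m ∈ xs
maxCand-∈ {x ∷ xs} eq with maxCand xs in eqₓₛ
maxCand-∈ {x ∷ xs} refl | nothing = here refl
maxCand-∈ {x ∷ xs} eq   | just m with ltCell (proj₂ (proj₂ x)) (proj₂ (proj₂ m))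
maxCand-∈ {x ∷ xs} refl | just m | true  = there (maxCand-∈ eqₓₛ)
maxCand-∈ {x ∷ xs} refl | just m | false = here refl

∈-range⁻ : ∀ {a b k} → k ∈ range a b → a ≤ k × k < b
∈-range⁻ {a} {b} k∈ with ∈-map⁻ (a +_) k∈
... | d , d∈ , refl = m≤m+n a d , (begin-strict
  a + d        <⟨ +-monoʳ-< a d<b∸a ⟩
  a + (b ∸ a)  ≡⟨ m+[n∸m]≡n {a} (<⇒≤ (m∸n≢0⇒n<m λ b∸a≡0 → n≮0 (subst (d <_) b∸a≡0 d<b∸a))) ⟩
  b            ∎)
  where
  open ≤-Reasoning
  d<b∸a : d < b ∸ a
  d<b∸a = ∈-upTo⁻ d∈

∈-range⁺ : ∀ {a b k} → a ≤ k → k < b → k ∈ range a b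
∈-range⁺ {a} {b} a≤k k<b =
  subst (_∈ range a b) (m+[n∸m]≡n a≤k) (∈-map⁺ (a +_) (∈-upTo⁺ (∸-monoˡ-< k<b a≤k)))

length-range : ∀ a b → length (range a b) ≡ b ∸ a
length-range a b = trans (length-map (a +_) (upTo (b ∸ a))) (length-upTo (b ∸ a))

skewRow : List ℕ → List ℕ → ℕ → List Cell
skewRow ν ρ i = map (i ,_) (range (part ρ i) (part ν i))

length-skewRow : ∀ ν ρ i → length (skewRow ν ρ i) ≡ part ν i ∸ part ρ i
length-skewRow ν ρ i = trans (length-map (i ,_) (range (part ρ i) (part ν i))) (length-range (part ρ i) (part ν i))

∈D⇒<length : ∀ {ν i j} → (i , j) ∈D ν → i < length ν
∈D⇒<length {_ ∷ _} {zero}  _  = s≤s z≤n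
∈D⇒<length {_ ∷ ν} {suc i} ij = s≤s (∈D⇒<length {ν} {i} ij)

∈-skewCells⁻ : ∀ {ν ρ c} → c ∈ skewCells ν ρ → InSkew ν ρ c
∈-skewCells⁻ {ν} {ρ} c∈ with satisfied (∈-concatMap⁻ (skewRow ν ρ) {xs = upTo (length ν)} c∈)
... | i , c∈row with ∈-map⁻ (i ,_) c∈row
... | j , j∈ , refl with ∈-range⁻ j∈
... | ρᵢ≤j , j<νᵢ = j<νᵢ , ≤⇒≯ ρᵢ≤j

∈-skewCells⁺ : ∀ {ν ρ c} → InSkew ν ρ c → c ∈ skewCells ν ρ
∈-skewCells⁺ {ν} {ρ} {i , j} (j<νᵢ , j≮ρᵢ) =
  ∈-concatMap⁺ (skewRow ν ρ) {xs = upTo (length ν)}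
    (lose (∈-upTo⁺ (∈D⇒<length {ν} j<νᵢ)) (∈-map⁺ (i ,_) (∈-range⁺ (≮⇒≥ j≮ρᵢ) j<νᵢ)))

∈-blockOf⁻ : ∀ {ρ s c a} → (c , a) ∈ blockOf ρ s → InSkew (shape s) ρ c × a ≡ filling s c
∈-blockOf⁻ {ρ} {s} ca∈ with ∈-map⁻ (λ c → c , filling s c) ca∈
... | _ , c∈ , refl = ∈-skewCells⁻ {shape s} {ρ} c∈ , refl

∈-blockOf⁺ : ∀ {ρ s c} → InSkew (shape s) ρ c → (c , filling s c) ∈ blockOf ρ s
∈-blockOf⁺ {ρ} {s} c∈ = ∈-map⁺ (λ c → c , filling s c) (∈-skewCells⁺ {shape s} {ρ} c∈)

length-concatMap-empty : ∀ {A : Set} (g : ℕ → List A) {xs}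
  → All (λ i → length (g i) ≡ 0) xs → length (concatMap g xs) ≡ 0
length-concatMap-empty g []                       = refl
length-concatMap-empty g {x ∷ xs} (gx≡0 ∷ gxs≡0) = begin
  length (g x ++ concatMap g xs)         ≡⟨ length-++ (g x) ⟩
  length (g x) + length (concatMap g xs) ≡⟨ cong₂ _+_ gx≡0 (length-concatMap-empty g gxs≡0) ⟩
  0                                      ∎
  where open ≡-Reasoning

length-concatMap-supported : ∀ {A : Set} (g : ℕ → List A) {r xs} → Unique xs
  → (∀ i → i ≢ r → length (g i) ≡ 0) → length (concatMap g xs) ≤ length (g r)
length-concatMap-supported g {r} {[]}     _            _     = z≤n
length-concatMap-supported g {r} {x ∷ xs} (x∉xs ∷ uxs) empty with x ≟ r
... | yes refl = ≤-reflexive (begin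
  length (g x ++ concatMap g xs)         ≡⟨ length-++ (g x) ⟩
  length (g x) + length (concatMap g xs) ≡⟨ cong (length (g x) +_) rest≡0 ⟩
  length (g x) + 0                       ≡⟨ +-identityʳ _ ⟩
  length (g x)                           ∎)
  where
  open ≡-Reasoning
  rest≡0 : length (concatMap g xs) ≡ 0
  rest≡0 = length-concatMap-empty g (All.map (λ x≢i → empty _ (x≢i ∘ sym)) x∉xs)
... | no x≢r = begin
  length (g x ++ concatMap g xs)         ≡⟨ length-++ (g x) ⟩
  length (g x) + length (concatMap g xs) ≡⟨ cong (_+ length (concatMap g xs)) (empty x x≢r) ⟩
  length (concatMap g xs)                ≤⟨ length-concatMap-supported g uxs empty ⟩
  length (g r)                           ∎
  where open ≤-Reasoning

length-skewCells-≤ : ∀ ν ρ r → (∀ i → i ≢ r → part ρ i ≡ part ν i)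
  → length (skewCells ν ρ) ≤ part ν r ∸ part ρ r
length-skewCells-≤ ν ρ r same = begin
  length (skewCells ν ρ)  ≤⟨ length-concatMap-supported (skewRow ν ρ) (upTo⁺ (length ν)) empty ⟩
  length (skewRow ν ρ r)  ≡⟨ length-skewRow ν ρ r ⟩
  part ν r ∸ part ρ r     ∎
  where
  open ≤-Reasoning
  empty : ∀ i → i ≢ r → length (skewRow ν ρ i) ≡ 0
  empty i i≢r = trans (length-skewRow ν ρ i) (trans (cong (part ν i ∸_) (same i i≢r)) (n∸n≡0 (part ν i)))

Decreasing : List ℕ → Set
Decreasing p = ∀ i → part p (suc i) ≤ part p i

linked⇒decreasing : ∀ {p} → Linked (λ a b → b ≤ a) p → Decreasing p
linked⇒decreasing []          _       = z≤n
linked⇒decreasing [-]         _       = z≤n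
linked⇒decreasing (y≤x ∷ _)   zero    = y≤x
linked⇒decreasing (_   ∷ yxs) (suc i) = linked⇒decreasing yxs i

decreasing⇒partition++zeros : ∀ {p} → Decreasing p → ∃₂ λ ys n → p ≡ ys ++ replicate n 0 × IsPartition ys
decreasing⇒partition++zeros {[]} _ = [] , 0 , refl , [] , []
decreasing⇒partition++zeros {x ∷ p} dec with decreasing⇒partition++zeros {p} (dec ∘ suc)
decreasing⇒partition++zeros {zero  ∷ _} dec | []    , n , refl , _ = [] , suc n , refl , [] , []
decreasing⇒partition++zeros {zero  ∷ _} dec | y ∷ _ , n , refl , _ , 0<y ∷ _ = ⊥-elim (<⇒≱ 0<y (dec 0))
decreasing⇒partition++zeros {suc x ∷ _} dec | []    , n , refl , _ = [ suc x ] , n , refl , [-] , s≤s z≤n ∷ []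
decreasing⇒partition++zeros {suc x ∷ _} dec | y ∷ ys , n , refl , lin , pos =
  suc x ∷ y ∷ ys , n , refl , dec 0 ∷ lin , s≤s z≤n ∷ pos

part-++-zeros : ∀ ys n i → part (ys ++ replicate n 0) i ≡ part ys i
part-++-zeros []       zero    i       = refl
part-++-zeros []       (suc n) zero    = refl
part-++-zeros []       (suc n) (suc i) = part-++-zeros [] n i
part-++-zeros (y ∷ ys) n       zero    = refl
part-++-zeros (y ∷ ys) n       (suc i) = part-++-zeros ys n i

reverse-replicate : ∀ n (x : ℕ) → reverse (replicate n x) ≡ replicate n x
reverse-replicate zero    x = refl
reverse-replicate (suc n) x = begin
  reverse (x ∷ replicate n x)      ≡⟨ unfold-reverse x (replicate n x) ⟩
  reverse (replicate n x) ++ [ x ] ≡⟨ cong (_++ [ x ]) (reverse-replicate n x) ⟩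
  replicate n x ++ [ x ]           ≡⟨ replicate-++-[x] n ⟩
  x ∷ replicate n x                ∎
  where
  open ≡-Reasoning
  replicate-++-[x] : ∀ n → replicate n x ++ [ x ] ≡ x ∷ replicate n x
  replicate-++-[x] zero    = refl
  replicate-++-[x] (suc n) = cong (x ∷_) (replicate-++-[x] n)

isZero : ℕ → Bool
isZero x = x ≡ᵇ 0

dropWhile-isZero-zeros : ∀ n zs → dropWhileᵇ isZero (replicate n 0 ++ zs) ≡ dropWhileᵇ isZero zs
dropWhile-isZero-zeros zero    zs = refl
dropWhile-isZero-zeros (suc n) zs = dropWhile-isZero-zeros n zs

dropWhile-isZero-id : ∀ zs → 0 ∉ zs → dropWhileᵇ isZero zs ≡ zs
dropWhile-isZero-id []           _   = refl
dropWhile-isZero-id (zero  ∷ zs) 0∉ = ⊥-elim (0∉ (here refl))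
dropWhile-isZero-id (suc z ∷ zs) _   = refl

stripZeros-++-zeros : ∀ ys n → All (0 <_) ys → stripZeros (ys ++ replicate n 0) ≡ ys
stripZeros-++-zeros ys n pos = begin
  reverse (dropWhileᵇ isZero (reverse (ys ++ replicate n 0)))
    ≡⟨ cong (reverse ∘ dropWhileᵇ isZero) (reverse-++ ys (replicate n 0)) ⟩
  reverse (dropWhileᵇ isZero (reverse (replicate n 0) ++ reverse ys))
    ≡⟨ cong (λ zs → reverse (dropWhileᵇ isZero (zs ++ reverse ys))) (reverse-replicate n 0) ⟩
  reverse (dropWhileᵇ isZero (replicate n 0 ++ reverse ys))
    ≡⟨ cong reverse (dropWhile-isZero-zeros n (reverse ys)) ⟩
  reverse (dropWhileᵇ isZero (reverse ys))
    ≡⟨ cong reverse (dropWhile-isZero-id (reverse ys) (λ 0∈ → n≮0 (All.lookup pos (reverse⁻ 0∈)))) ⟩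
  reverse (reverse ys)
    ≡⟨ reverse-involutive ys ⟩
  ys ∎
  where open ≡-Reasoning

stripZeros-decreasing : ∀ {p} → Decreasing p
  → IsPartition (stripZeros p) × (∀ i → part (stripZeros p) i ≡ part p i)
stripZeros-decreasing {p} dec with decreasing⇒partition++zeros {p} dec
... | ys , n , refl , ys-part rewrite stripZeros-++-zeros ys n (proj₂ ys-part) =
  ys-part , λ i → sym (part-++-zeros ys n i)

IsCorner : List ℕ → Cell → Set
IsCorner ν (r , j) = part ν r ≡ suc j × part ν (suc r) ≤ j

part-decAt-≡ : ∀ ν r → part (decAt ν r) r ≡ part ν r ∸ 1
part-decAt-≡ []      r       = refl
part-decAt-≡ (x ∷ ν) zero    = refl
part-decAt-≡ (x ∷ ν) (suc r) = part-decAt-≡ ν r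

part-decAt-≢ : ∀ ν {r i} → i ≢ r → part (decAt ν r) i ≡ part ν i
part-decAt-≢ []      _   = refl
part-decAt-≢ (x ∷ ν) {zero}  {zero}  i≢r = ⊥-elim (i≢r refl)
part-decAt-≢ (x ∷ ν) {zero}  {suc i} _   = refl
part-decAt-≢ (x ∷ ν) {suc r} {zero}  _   = refl
part-decAt-≢ (x ∷ ν) {suc r} {suc i} i≢r = part-decAt-≢ ν (i≢r ∘ cong suc)

part-decAt-corner : ∀ ν {r j} → IsCorner ν (r , j) → part (decAt ν r) r ≡ j
part-decAt-corner ν {r} (νᵣ≡1+j , _) = trans (part-decAt-≡ ν r) (cong (_∸ 1) νᵣ≡1+j)

decAt-corner-decreasing : ∀ {ν r j} → Decreasing ν → IsCorner ν (r , j) → Decreasing (decAt ν r)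
decAt-corner-decreasing {ν} {r} {j} dec corner@(νᵣ≡1+j , νᵣ₊₁≤j) i with i ≟ r | suc i ≟ r
... | yes refl | _ = begin
  part (decAt ν r) (suc r) ≡⟨ part-decAt-≢ ν (λ ()) ⟩
  part ν (suc r)           ≤⟨ νᵣ₊₁≤j ⟩
  j                        ≡⟨ sym (part-decAt-corner ν corner) ⟩
  part (decAt ν r) r       ∎
  where open ≤-Reasoning
... | no i≢r | yes refl = begin
  part (decAt ν r) r ≡⟨ part-decAt-corner ν corner ⟩
  j                  ≤⟨ n≤1+n j ⟩
  suc j              ≡⟨ sym νᵣ≡1+j ⟩
  part ν (suc i)     ≤⟨ dec i ⟩
  part ν i           ≡⟨ sym (part-decAt-≢ ν i≢r) ⟩
  part (decAt ν r) i ∎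
  where open ≤-Reasoning
... | no i≢r | no 1+i≢r = begin
  part (decAt ν r) (suc i) ≡⟨ part-decAt-≢ ν 1+i≢r ⟩
  part ν (suc i)           ≤⟨ dec i ⟩
  part ν i                 ≡⟨ sym (part-decAt-≢ ν i≢r) ⟩
  part (decAt ν r) i       ∎
  where open ≤-Reasoning

module _ {ν r j} (ν-part : IsPartition ν) (corner : IsCorner ν (r , j)) where
  private
    strip : IsPartition (removeCell ν (r , j)) × (∀ i → part (removeCell ν (r , j)) i ≡ part (decAt ν r) i)
    strip = stripZeros-decreasing {decAt ν r} (decAt-corner-decreasing {ν} (linked⇒decreasing (proj₁ ν-part)) corner)

  removeCorner-partition : IsPartition (removeCell ν (r , j))
  removeCorner-partition = proj₁ strip

  part-removeCorner-≡ : part (removeCell ν (r , j)) r ≡ j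
  part-removeCorner-≡ = trans (proj₂ strip r) (part-decAt-corner ν corner)

  part-removeCorner-≢ : ∀ {i} → i ≢ r → part (removeCell ν (r , j)) i ≡ part ν i
  part-removeCorner-≢ {i} i≢r = trans (proj₂ strip i) (part-decAt-≢ ν i≢r)

  removeCorner-⊆ : removeCell ν (r , j) ⊆D ν
  removeCorner-⊆ (i , k) k<ν′ᵢ with i ≟ r
  ... | yes refl = <-trans (subst (k <_) part-removeCorner-≡ k<ν′ᵢ) (subst (j <_) (sym (proj₁ corner)) (n<1+n j))
  ... | no i≢r   = subst (k <_) (part-removeCorner-≢ i≢r) k<ν′ᵢ

  removeCorner-≢ : removeCell ν (r , j) ≢ ν
  removeCorner-≢ ν′≡ν = <-irrefl (sym part-removeCorner-≡)
    (subst (λ μ → j < part μ r) (sym ν′≡ν) (subst (j <_) (sym (proj₁ corner)) (n<1+n j)))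

  ⊆-removeCorner : ∀ {ρ} → ρ ⊆D ν → ¬ (r , j) ∈D ρ → ρ ⊆D removeCell ν (r , j)
  ⊆-removeCorner {ρ} ρ⊆ν c∉ρ (i , k) k<ρᵢ with i ≟ r
  ... | yes refl = subst (k <_) (sym part-removeCorner-≡) (<-≤-trans k<ρᵢ (≮⇒≥ c∉ρ))
  ... | no i≢r   = subst (k <_) (sym (part-removeCorner-≢ i≢r)) (ρ⊆ν (i , k) k<ρᵢ)

  length-skewCells-removeCorner : length (skewCells ν (removeCell ν (r , j))) ≤ 1
  length-skewCells-removeCorner = begin
    length (skewCells ν (removeCell ν (r , j))) ≤⟨ length-skewCells-≤ ν (removeCell ν (r , j)) r (λ _ → part-removeCorner-≢) ⟩
    part ν r ∸ part (removeCell ν (r , j)) r    ≡⟨ cong₂ _∸_ (proj₁ corner) part-removeCorner-≡ ⟩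
    suc j ∸ j                                   ≡⟨ m+n∸n≡m 1 j ⟩
    1                                           ∎
    where open ≤-Reasoning

IsSSYT-mono : ∀ {ν ρ ν′ ρ′ f} → (∀ {c} → InSkew ν′ ρ′ c → InSkew ν ρ c) → IsSSYT ν ρ f → IsSSYT ν′ ρ′ f
IsSSYT-mono sub (pos , row , col) =
  (λ c c∈ → pos c (sub c∈)) ,
  (λ i j j′ c∈ c′∈ → row i j j′ (sub c∈) (sub c′∈)) ,
  (λ i i′ j c∈ c′∈ → col i i′ j (sub c∈) (sub c′∈))

-- A copy of the local test ok of isSSYTᵇ, which Defs does not export.
compatibleᵇ : Entry → Entry → Bool
compatibleᵇ ((i , j) , a) ((i′ , j′) , a′) =
    (not ((i ≡ᵇ i′) ∧ (j <ᵇ j′)) ∨ not (a′ <ᵇ a))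
  ∧ (not ((j ≡ᵇ j′) ∧ (i <ᵇ i′)) ∨ (a <ᵇ a′))

Compatible : Entry → Entry → Set
Compatible ((i , j) , a) ((i′ , j′) , a′) =
  (i ≡ i′ × j < j′ → ¬ a′ < a) × (j ≡ j′ × i < i′ → a < a′)

compatibleᵇ-reflects : ∀ d e → Reflects (Compatible d e) (compatibleᵇ d e)
compatibleᵇ-reflects ((i , j) , a) ((i′ , j′) , a′) =
     ((≡ᵇ-reflects-≡ i i′ ×-reflects <ᵇ-reflects-< j j′) →-reflects ¬-reflects (<ᵇ-reflects-< a′ a))
  ×-reflects ((≡ᵇ-reflects-≡ j j′ ×-reflects <ᵇ-reflects-< i i′) →-reflects <ᵇ-reflects-< a a′)

IsSSYT-fromᵇ : ∀ {ν ρ f B} → T (isSSYTᵇ B) → (∀ {c} → InSkew ν ρ c → (c , f c) ∈ B) → IsSSYT ν ρ f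
IsSSYT-fromᵇ {ν} {ρ} {f} {B} ok mem =
  (λ c c∈ → ≮⇒≥ (T⇒reflected (¬-reflects (<ᵇ-reflects-< (f c) 1)) (All.lookup pos (mem c∈)))) ,
  (λ i j j′ c∈ c′∈ j<j′ → ≮⇒≥ (proj₁ (compatible c∈ c′∈) (refl , j<j′))) ,
  (λ i i′ j c∈ c′∈ i<i′ → proj₂ (compatible c∈ c′∈) (refl , i<i′))
  where
  pos = T-allB (proj₁ (to T-∧ ok))
  compatible : ∀ {c c′} → InSkew ν ρ c → InSkew ν ρ c′ → Compatible (c , f c) (c′ , f c′)
  compatible {c} {c′} c∈ c′∈ = T⇒reflected (compatibleᵇ-reflects (c , f c) (c′ , f c′))
    (All.lookup (T-allB (All.lookup (T-allB (proj₂ (to T-∧ ok))) (mem c∈))) (mem c′∈))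

maximal-cell-corner : ∀ {ν ρ f r j} → IsPartition ρ → IsSSYT ν ρ f → InSkew ν ρ (r , j)
  → (∀ {d} → InSkew ν ρ d → ¬ ((r , j) , f (r , j)) ≺ (d , f d)) → IsCorner ν (r , j)
maximal-cell-corner {ν} {ρ} {f} {r} {j} (ρ-lin , _) (_ , row , col) c∈@(j<νᵣ , j≮ρᵣ) maximal =
  ≤-antisym (≮⇒≥ right-outside) j<νᵣ , ≮⇒≥ below-outside
  where
  ρᵣ≤j : part ρ r ≤ j
  ρᵣ≤j = ≮⇒≥ j≮ρᵣ
  right-outside : ¬ suc j < part ν r
  right-outside 1+j<νᵣ = maximal right (≺-row (n<1+n j) (row r j (suc j) c∈ right (n<1+n j)))
    where
    right : InSkew ν ρ (r , suc j)
    right = 1+j<νᵣ , ≤⇒≯ (m≤n⇒m≤1+n ρᵣ≤j)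
  below-outside : ¬ j < part ν (suc r)
  below-outside j<νᵣ₊₁ = maximal below (inj₁ (col r (suc r) j c∈ below (n<1+n r)))
    where
    below : InSkew ν ρ (suc r , j)
    below = j<νᵣ₊₁ , ≤⇒≯ (≤-trans (linked⇒decreasing ρ-lin r) ρᵣ≤j)

splitStep-valid : ∀ {prev lam s ss c a} → IsPartition prev → ValidFrom prev lam (s ∷ ss)
  → 1 < length (blockOf prev s) → maxEntry (blockOf prev s) ≡ just (c , a)
  → ValidFrom prev lam (applySplit 0 c (s ∷ ss))
splitStep-valid {prev} {s = s} {c = r , j} prev-part (ν-part , prev⊆ν , _ , ssyt , rest) 1<len max =
  removeCorner-partition ν-part corner , prev⊆ν′ , prev≢ν′ , IsSSYT-mono {ν} {prev} {ν′} {prev} ν′/prev⊆ν/prev ssyt ,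
  ν-part , removeCorner-⊆ ν-part corner , removeCorner-≢ ν-part corner ,
  IsSSYT-mono {ν} {prev} {ν} {ν′} ν/ν′⊆ν/prev ssyt , rest
  where
  ν = shape s
  ν′ = removeCell ν (r , j)
  maximal = maxEntry-maximal (blockOf prev s) max
  c∈ν/prev : InSkew ν prev (r , j)
  c∈ν/prev = proj₁ (∈-blockOf⁻ {prev} {s} (proj₁ maximal))
  corner : IsCorner ν (r , j)
  corner = maximal-cell-corner {ν} prev-part ssyt c∈ν/prev λ d∈ →
    subst (λ a → ¬ ((r , j) , a) ≺ _) (proj₂ (∈-blockOf⁻ {prev} {s} (proj₁ maximal)))
      (proj₂ maximal (∈-blockOf⁺ {prev} {s} d∈))
  prev⊆ν′ : prev ⊆D ν′
  prev⊆ν′ = ⊆-removeCorner ν-part corner {prev} prev⊆ν (proj₂ c∈ν/prev)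
  prev≢ν′ : prev ≢ ν′
  prev≢ν′ prev≡ν′ = <⇒≱ 1<len (begin
    length (blockOf prev s)   ≡⟨ length-map _ (skewCells ν prev) ⟩
    length (skewCells ν prev) ≡⟨ cong (length ∘ skewCells ν) prev≡ν′ ⟩
    length (skewCells ν ν′)   ≤⟨ length-skewCells-removeCorner ν-part corner ⟩
    1                         ∎)
    where open ≤-Reasoning
  ν′/prev⊆ν/prev : ∀ {d} → InSkew ν′ prev d → InSkew ν prev d
  ν′/prev⊆ν/prev (d∈ν′ , d∉prev) = removeCorner-⊆ {ν} ν-part corner _ d∈ν′ , d∉prev
  ν/ν′⊆ν/prev : ∀ {d} → InSkew ν ν′ d → InSkew ν prev d
  ν/ν′⊆ν/prev (d∈ν , d∉ν′) = d∈ν , d∉ν′ ∘ prev⊆ν′ _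

cellEq-reflects : ∀ c d → Reflects (proj₁ c ≡ proj₁ d × proj₂ c ≡ proj₂ d) (cellEq c d)
cellEq-reflects (i , j) (i′ , j′) = ≡ᵇ-reflects-≡ i i′ ×-reflects ≡ᵇ-reflects-≡ j j′

mergeStep-valid : ∀ {prev lam s s′ ss c a} → ValidFrom prev lam (s ∷ s′ ∷ ss)
  → blockOf (shape s) s′ ≡ [ (c , a) ] → T (isSSYTᵇ (blockOf prev s ++ [ (c , a) ]))
  → ValidFrom prev lam (applyMerge 1 (c , a) (s ∷ s′ ∷ ss))
mergeStep-valid {prev} {s = s} {s′} {c = c} {a}
                (_ , prev⊆ν , _ , _ , ν′-part , ν⊆ν′ , _ , _ , rest) block≡[c] ok =
  ν′-part , (λ d → ν⊆ν′ d ∘ prev⊆ν d) , prev≢ν′ , IsSSYT-fromᵇ {ν′} {prev} ok entry∈ , rest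
  where
  ν = shape s
  ν′ = shape s′
  c∈ν′/ν : InSkew ν′ ν c
  c∈ν′/ν = proj₁ (∈-blockOf⁻ {ν} {s′} (subst ((c , a) ∈_) (sym block≡[c]) (here refl)))
  only-c : ∀ {d} → InSkew ν′ ν d → d ≡ c
  only-c d∈ with subst (_ ∈_) block≡[c] (∈-blockOf⁺ {ν} {s′} d∈)
  ... | here d,fd≡c,a = cong proj₁ d,fd≡c,a
  prev≢ν′ : prev ≢ ν′
  prev≢ν′ prev≡ν′ = proj₂ c∈ν′/ν (prev⊆ν c (subst (c ∈D_) (sym prev≡ν′) (proj₁ c∈ν′/ν)))
  merged : Cell → ℕ
  merged d = if cellEq d c then a else filling s d
  entry∈ : ∀ {d} → InSkew ν′ prev d → (d , merged d) ∈ blockOf prev s ++ [ (c , a) ]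
  entry∈ {i , k} (k<ν′ᵢ , d∉prev) with k <? part ν i
  ... | yes k<νᵢ with cellEq (i , k) c | cellEq-reflects (i , k) c
  ...   | true  | ofʸ (refl , refl) = ⊥-elim (proj₂ c∈ν′/ν k<νᵢ)
  ...   | false | ofⁿ _ = ∈-++⁺ˡ (∈-blockOf⁺ {prev} {s} (k<νᵢ , d∉prev))
  entry∈ {i , k} (k<ν′ᵢ , d∉prev) | no k≮νᵢ with only-c (k<ν′ᵢ , k≮νᵢ)
  ... | refl with cellEq (i , k) (i , k) | cellEq-reflects (i , k) (i , k)
  ...   | true  | ofʸ _   = ∈-++⁺ʳ (blockOf prev s) (here refl)
  ...   | false | ofⁿ i,k≢i,k = ⊥-elim (i,k≢i,k (refl , refl))

shiftCand : Cand → Cand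
shiftCand (idx , k , e) = suc idx , k , e

splitC-suc : ∀ idx b → splitC (suc idx) b ≡ map shiftCand (splitC idx b)
splitC-suc idx b with 1 <ᵇ length b | maxEntry b
... | true  | just _  = refl
... | true  | nothing = refl
... | false | _       = refl

mergeC-suc : ∀ idx pb b → mergeC (suc idx) pb b ≡ map shiftCand (mergeC idx pb b)
mergeC-suc idx nothing   b        = refl
mergeC-suc idx (just pb) []       = refl
mergeC-suc idx (just pb) (c ∷ []) with isSSYTᵇ (pb ++ [ c ]) ∧ allB (λ d → ltCell d c) pb
... | true  = refl
... | false = refl
mergeC-suc idx (just pb) (_ ∷ _ ∷ _) = refl

cands-suc : ∀ idx prev pb ss → cands (suc idx) prev pb ss ≡ map shiftCand (cands idx prev pb ss)
cands-suc idx prev pb []       = refl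
cands-suc idx prev pb (s ∷ ss) = begin
  splitC (suc idx) b ++ mergeC (suc idx) pb b ++ cands (suc (suc idx)) (shape s) (just b) ss
    ≡⟨ cong₂ _++_ (splitC-suc idx b) (cong₂ _++_ (mergeC-suc idx pb b) (cands-suc (suc idx) (shape s) (just b) ss)) ⟩
  map shiftCand (splitC idx b) ++ map shiftCand (mergeC idx pb b) ++ map shiftCand (cands (suc idx) (shape s) (just b) ss)
    ≡⟨ cong (map shiftCand (splitC idx b) ++_) (map-++ shiftCand (mergeC idx pb b) _) ⟨
  map shiftCand (splitC idx b) ++ map shiftCand (mergeC idx pb b ++ cands (suc idx) (shape s) (just b) ss)
    ≡⟨ map-++ shiftCand (splitC idx b) _ ⟨
  map shiftCand (splitC idx b ++ mergeC idx pb b ++ cands (suc idx) (shape s) (just b) ss) ∎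
  where
  open ≡-Reasoning
  b = blockOf prev s

∈-cands-∷ : ∀ prev pb s ss {x} → x ∈ cands 0 prev pb (s ∷ ss)
  → x ∈ splitC 0 (blockOf prev s)
  ⊎ x ∈ mergeC 0 pb (blockOf prev s)
  ⊎ ∃ λ y → y ∈ cands 0 (shape s) (just (blockOf prev s)) ss × x ≡ shiftCand y
∈-cands-∷ prev pb s ss x∈ with ∈-++⁻ (splitC 0 (blockOf prev s)) x∈
... | inj₁ x∈split = inj₁ x∈split
... | inj₂ x∈rest with ∈-++⁻ (mergeC 0 pb (blockOf prev s)) x∈rest
...   | inj₁ x∈merge = inj₂ (inj₁ x∈merge)
...   | inj₂ x∈later = inj₂ (inj₂ (∈-map⁻ shiftCand
          (subst (_ ∈_) (cands-suc 0 (shape s) (just (blockOf prev s)) ss) x∈later)))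

∈-splitC : ∀ idx b {m k e} → (m , k , e) ∈ splitC idx b
  → m ≡ idx × k ≡ splitK × 1 < length b × maxEntry b ≡ just e
∈-splitC idx b x∈ with 1 <ᵇ length b | <ᵇ-reflects-< 1 (length b) | maxEntry b
∈-splitC idx b (here refl) | true | ofʸ 1<len | just _ = refl , refl , 1<len , refl

∈-mergeC : ∀ idx pb b {m k e} → (m , k , e) ∈ mergeC idx pb b
  → m ≡ idx × k ≡ mergeK × ∃ λ pb′ → pb ≡ just pb′ × b ≡ [ e ] × T (isSSYTᵇ (pb′ ++ [ e ]))
∈-mergeC idx (just pb) (c ∷ []) x∈ with isSSYTᵇ (pb ++ [ c ]) in ok | allB (λ d → ltCell d c) pb
∈-mergeC idx (just pb) (c ∷ []) (here refl) | true | true = refl , refl , pb , refl , refl , from T-≡ ok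

applySplit-valid : ∀ {prev lam pb ss m c a} → IsPartition prev → ValidFrom prev lam ss
  → (m , splitK , (c , a)) ∈ cands 0 prev pb ss → ValidFrom prev lam (applySplit m c ss)
applySplit-valid {prev} {pb = pb} {s ∷ ss} prev-part v@(ν-part , prev⊆ν , prev≢ν , ssyt , rest) x∈
  with ∈-cands-∷ prev pb s ss x∈
... | inj₁ x∈split with refl , _ , 1<len , max ← ∈-splitC 0 (blockOf prev s) x∈split =
  splitStep-valid prev-part v 1<len max
... | inj₂ (inj₁ x∈merge) with _ , () , _ ← ∈-mergeC 0 pb (blockOf prev s) x∈merge
... | inj₂ (inj₂ (_ , y∈ , refl)) = ν-part , prev⊆ν , prev≢ν , ssyt , applySplit-valid ν-part rest y∈

applyMerge-suc-valid : ∀ {prev lam s ss m e} → ValidFrom prev lam (s ∷ ss)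
  → (m , mergeK , e) ∈ cands 0 (shape s) (just (blockOf prev s)) ss
  → ValidFrom prev lam (applyMerge (suc m) e (s ∷ ss))
applyMerge-suc-valid {prev} {s = s} {s′ ∷ ss} v@(ν-part , prev⊆ν , prev≢ν , ssyt , rest) x∈
  with ∈-cands-∷ (shape s) (just (blockOf prev s)) s′ ss x∈
... | inj₁ x∈split with _ , () , _ ← ∈-splitC 0 (blockOf (shape s) s′) x∈split
... | inj₂ (inj₁ x∈merge)
  with refl , _ , _ , refl , block≡[e] , ok ← ∈-mergeC 0 (just (blockOf prev s)) (blockOf (shape s) s′) x∈merge =
  mergeStep-valid v block≡[e] ok
... | inj₂ (inj₂ (_ , y∈ , refl)) = ν-part , prev⊆ν , prev≢ν , ssyt , applyMerge-suc-valid rest y∈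

applyMerge-valid : ∀ {μ lam T m e} → ValidFrom μ lam T
  → (m , mergeK , e) ∈ cands 0 μ nothing T → ValidFrom μ lam (applyMerge m e T)
applyMerge-valid {μ} {T = s ∷ ss} v x∈ with ∈-cands-∷ μ nothing s ss x∈
... | inj₁ x∈split with _ , () , _ ← ∈-splitC 0 (blockOf μ s) x∈split
... | inj₂ (inj₁ x∈merge) with _ , _ , _ , () , _ ← ∈-mergeC 0 nothing (blockOf μ s) x∈merge
... | inj₂ (inj₂ (_ , y∈ , refl)) = applyMerge-suc-valid v y∈

-- The hypotheses on lam follow from InX μ lam T.
lemma2p2 : (μ lam : List ℕ) → IsPartition μ → IsPartition lam → μ ⊆D lam
           → (T : List Step) → InX μ lam T → InX μ lam (Φ μ T)
lemma2p2 μ lam μ-part _ _ T v with maxCand (cands 0 μ nothing T) in max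
... | nothing                    = v
... | just (m , splitK , (c , a)) = applySplit-valid μ-part v (maxCand-∈ max)
... | just (m , mergeK , e)       = applyMerge-valid v (maxCand-∈ max)
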